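{- Let $\{S_{\Phi}\}_{\Phi \subseteq \mathsf{At}}$ with projections $(r^{\Phi}_{\Psi})_{\Psi \subseteq \Phi \subseteq \mathsf{At}}$ be a lattice of state spaces as described in the context, $\Omega = \bigcup_{\Phi} S_\Phi$, and let $\Lambda_i : \Omega \to 2^\Omega$ satisfy Strong Confinement (for any $\Phi \subseteq \mathsf{At}$ and $\omega \in S_\Phi$, $\Lambda_i(\omega) \subseteq S_\Phi$) and Projections Preserve Implicit Knowledge (for any $\Phi \subseteq \mathsf{At}$, if $\omega \in S_\Phi$ then $\Lambda_i(\omega)_\Psi = \Lambda_i(\omega_\Psi)$ for all $\Psi \subseteq \Phi$). Then $\Lambda_i$ satisfies Projections Preserve Implicit Ignorance: for all $\Phi \subseteq \mathsf{At}$, if $\omega \in S_\Phi$ then $\Lambda_i^{\uparrow}(\omega) \subseteq \Lambda_i^{\uparrow}(\omega_\Psi)$ for all $\Psi \subseteq \Phi$.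
   Context: Fix a nonempty set $\mathsf{At}$ of atomic formulas. For each $\Phi \subseteq \mathsf{At}$ there is a nonempty state space $S_\Phi$, the spaces being pairwise disjoint, and for each $\Psi \subseteq \Phi$ a surjection $r^\Phi_\Psi : S_\Phi \to S_\Psi$ with $r^\Phi_\Phi$ the identity and $r^\Phi_\Upsilon = r^\Psi_\Upsilon \circ r^\Phi_\Psi$ whenever $\Upsilon \subseteq \Psi \subseteq \Phi$. Notation: for $\omega \in S_\Phi$ and $\Psi \subseteq \Phi$, $\omega_\Psi := r^\Phi_\Psi(\omega)$; for $D \subseteq S_\Phi$, $D_\Psi := r^\Phi_\Psi(D)$. For $D \subseteq S_\Phi$, $D^{\uparrow} := \bigcup_{\Phi \subseteq \Psi \subseteq \mathsf{At}} (r^\Psi_\Phi)^{ -1}(D)$, and $\Lambda_i^{\uparrow}(\omega) := (\Lambda_i(\omega))^{\uparrow}$. -}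

module Defs where

open import Level using (0ℓ)
open import Data.Product using (Σ; Σ-syntax; ∃; _×_; _,_; proj₁; proj₂)
open import Relation.Binary.PropositionalEquality using (_≡_)
open import Relation.Unary using (Pred; _⊆_; _∈_)

Sub : Set → Set₁
Sub At = Pred At 0ℓ

record StateLattice (At : Set) : Set₁ where
  field
    S        : Sub At → Set
    nonempty : (Φ : Sub At) → S Φ
    r        : (Φ Ψ : Sub At) → Ψ ⊆ Φ → S Φ → S Ψ
    r-surj   : (Φ Ψ : Sub At) (p : Ψ ⊆ Φ) (t : S Ψ) → ∃ λ s → r Φ Ψ p s ≡ t
    r-id     : (Φ : Sub At) (p : Φ ⊆ Φ) (ω : S Φ) → r Φ Φ p ω ≡ ω
    r-comp   : (Φ Ψ Υ : Sub At) (p : Ψ ⊆ Φ) (q : Υ ⊆ Ψ) (pq : Υ ⊆ Φ) (ω : S Φ) →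
               r Φ Υ pq ω ≡ r Ψ Υ q (r Φ Ψ p ω)

  -- Ω = disjoint union of all state spaces; a state is tagged with its Φ,
  -- so ω ∈ S_Φ means proj₁ ω ≡ Φ.
  Ω : Set₁
  Ω = Σ (Sub At) S

  _↑ : {Φ : Sub At} → Pred (S Φ) 0ℓ → Pred Ω 0ℓ
  _↑ {Φ} D (Θ , ω′) = Σ[ p ∈ Φ ⊆ Θ ] (r Θ Φ p ω′ ∈ D)

  part : (Φ : Sub At) → Pred Ω 0ℓ → Pred (S Φ) 0ℓ
  part Φ X s = (Φ , s) ∈ X

  image : (Φ Ψ : Sub At) → Ψ ⊆ Φ → Pred (S Φ) 0ℓ → Pred (S Ψ) 0ℓ
  image Φ Ψ p D t = ∃ λ s → s ∈ D × r Φ Ψ p s ≡ t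

  Λ↑ : (Λ : Ω → Pred Ω 0ℓ) (Φ : Sub At) → S Φ → Pred Ω 0ℓ
  Λ↑ Λ Φ ω = part Φ (Λ (Φ , ω)) ↑

  StrongConfinement : (Ω → Pred Ω 0ℓ) → Set₁
  StrongConfinement Λ =
    (Φ : Sub At) (ω : S Φ) (x : Ω) → x ∈ Λ (Φ , ω) → proj₁ x ≡ Φ

  ProjPreserveKnowledge : (Ω → Pred Ω 0ℓ) → Set₁
  ProjPreserveKnowledge Λ =
    (Φ : Sub At) (ω : S Φ) (Ψ : Sub At) (p : Ψ ⊆ Φ) (t : S Ψ) →
      (image Φ Ψ p (part Φ (Λ (Φ , ω))) t → part Ψ (Λ (Ψ , r Φ Ψ p ω)) t)
    × (part Ψ (Λ (Ψ , r Φ Ψ p ω)) t → image Φ Ψ p (part Φ (Λ (Φ , ω))) t)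

  ProjPreserveIgnorance : (Ω → Pred Ω 0ℓ) → Set₁
  ProjPreserveIgnorance Λ =
    (Φ : Sub At) (ω : S Φ) (Ψ : Sub At) (p : Ψ ⊆ Φ) →
      Λ↑ Λ Φ ω ⊆ Λ↑ Λ Ψ (r Φ Ψ p ω)

{-# OPTIONS --safe #-}
module Submission where

-- A state ω′ ∈ S_Θ above Φ is also above Ψ, and by r^Θ_Ψ = r^Φ_Ψ ∘ r^Θ_Φ its
-- Ψ-projection is the Ψ-projection of ω′_Φ ∈ Λ(ω), hence lies in Λ(ω)_Ψ ⊆ Λ(ω_Ψ).

open import Defs
open import Level using (0ℓ)
open import Relation.Unary using (Pred; _⊆_)
open import Data.Product using (_,_; proj₁)
open import Relation.Binary.PropositionalEquality using (sym)

module _ {At : Set} (L : StateLattice At) where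
  open StateLattice L

  ↑-mono-image : (Φ Ψ : Sub At) (p : Ψ ⊆ Φ) (D : Pred (S Φ) 0ℓ) (E : Pred (S Ψ) 0ℓ) →
                 image Φ Ψ p D ⊆ E → D ↑ ⊆ E ↑
  ↑-mono-image Φ Ψ p D E D-Ψ⊆E {Θ , ω′} (q , ω′-Φ∈D) =
    qp , D-Ψ⊆E (r Θ Φ q ω′ , ω′-Φ∈D , sym (r-comp Θ Φ Ψ q p qp ω′))
    where
    qp : Ψ ⊆ Θ
    qp x = q (p x)

lemma4 : (At : Set) → At → (L : StateLattice At) →
    (Λ : StateLattice.Ω L → Pred (StateLattice.Ω L) 0ℓ) →
    StateLattice.StrongConfinement L Λ →
    StateLattice.ProjPreserveKnowledge L Λ →
    StateLattice.ProjPreserveIgnorance L Λ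
lemma4 At _ L Λ _ ppk Φ ω Ψ p =
  ↑-mono-image L Φ Ψ p (part Φ (Λ (Φ , ω))) (part Ψ (Λ (Ψ , r Φ Ψ p ω)))
    (λ {t} → proj₁ (ppk Φ ω Ψ p t))
  where open StateLattice L
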